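{- The relation $\{(E_n,E_m,E_{n+m}): n,m\ge 1\}$ is first-order definable in $(\mathcal{D};\sqsubseteq)$ augmented with finitely many finite digraphs as constants.
   Context: Digraphs are pairs $(V,E)$, $V$ nonempty finite, $E\subseteq V^2$ (loops allowed); $\mathcal{D}$ is the set of their isomorphism types; $G\sqsubseteq G'$ means $G$ is isomorphic to an induced substructure of $G'$. $E_n$ is the digraph on $n$ vertices with no edges (and no loops). A relation is definable if some first-order formula in the language of partial orders with the constants is satisfied exactly by the tuples of the relation. -}

module Defs where

open import Data.Nat using (ℕ; zero; suc; _+_; _≤_)
open import Data.Nat.Properties using (≤-trans; m≤m+n)
open import Data.Fin using (Fin)
open import Data.Bool using (Bool; false)
open import Data.Vec using (Vec; lookup)
open import Data.Product using (Σ; ∃; _×_; _,_)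
open import Relation.Binary.PropositionalEquality using (_≡_)
open import Relation.Nullary using (¬_)
open import Function.Definitions using (Injective; Surjective)

record Digraph : Set where
  constructor digraph
  field
    size     : ℕ
    nonempty : 1 ≤ size
    edge     : Fin size → Fin size → Bool
open Digraph public

-- G ⊑ H : G is isomorphic to an induced substructure of H
-- (an injective map on vertices preserving and reflecting edges).
_⊑_ : Digraph → Digraph → Set
G ⊑ H = Σ (Fin (size G) → Fin (size H)) λ f →
          Injective _≡_ _≡_ f ×
          (∀ i j → edge G i j ≡ edge H (f i) (f j))

-- Isomorphism of digraphs; the elements of 𝒟 are digraphs up to ≅,
-- so equality in the structure (𝒟;⊑) is interpreted as ≅.
_≅_ : Digraph → Digraph → Set
G ≅ H = Σ (Fin (size G) → Fin (size H)) λ f →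
          Injective _≡_ _≡_ f ×
          Surjective _≡_ _≡_ f ×
          (∀ i j → edge G i j ≡ edge H (f i) (f j))

E : (n : ℕ) → 1 ≤ n → Digraph
E n p = digraph n p (λ _ _ → false)

-- First-order logic in the language {⊑} with equality and
-- k constant symbols, n free variables (de Bruijn).

data Term (k n : ℕ) : Set where
  var   : Fin n → Term k n
  const : Fin k → Term k n

-- Classical FO logic with primitive connectives ¬, ∧, ∀
-- (∨, →, ∃ are classical abbreviations).
data Formula (k : ℕ) : ℕ → Set where
  _⊑'_ : ∀ {n} → Term k n → Term k n → Formula k n
  _≐_  : ∀ {n} → Term k n → Term k n → Formula k n
  ¬'_  : ∀ {n} → Formula k n → Formula k n
  _∧'_ : ∀ {n} → Formula k n → Formula k n → Formula k n
  ∀'_  : ∀ {n} → Formula k (suc n) → Formula k n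

extend : ∀ {n} → Digraph → (Fin n → Digraph) → Fin (suc n) → Digraph
extend G ρ Fin.zero    = G
extend G ρ (Fin.suc i) = ρ i

evalT : ∀ {k n} → Vec Digraph k → (Fin n → Digraph) → Term k n → Digraph
evalT cs ρ (var i)   = ρ i
evalT cs ρ (const c) = lookup cs c

Sat : ∀ {k n} → Vec Digraph k → (Fin n → Digraph) → Formula k n → Set
Sat cs ρ (s ⊑' t) = evalT cs ρ s ⊑ evalT cs ρ t
Sat cs ρ (s ≐ t)  = evalT cs ρ s ≅ evalT cs ρ t
Sat cs ρ (¬' φ)   = ¬ Sat cs ρ φ
Sat cs ρ (φ ∧' ψ) = Sat cs ρ φ × Sat cs ρ ψ
Sat cs ρ (∀' φ)   = (G : Digraph) → Sat cs (extend G ρ) φ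

env3 : Digraph → Digraph → Digraph → Fin 3 → Digraph
env3 A B C Fin.zero                    = A
env3 A B C (Fin.suc Fin.zero)          = B
env3 A B C (Fin.suc (Fin.suc Fin.zero)) = C

-- The relation {(E_n, E_m, E_{n+m}) : n, m ≥ 1}, on isomorphism types.
EdgelessSum : Digraph → Digraph → Digraph → Set
EdgelessSum A B C =
  Σ ℕ λ n → Σ (1 ≤ n) λ p → Σ ℕ λ m → Σ (1 ≤ m) λ q →
    A ≅ E n p × B ≅ E m q × C ≅ E (n + m) (≤-trans p (m≤m+n n m))

module Submission where

-- Addition is encoded by matching graphs (loopless, every vertex adjacent to at most one other),
-- whose independence number counts their components.  Being edgeless, being a matching graph and
-- having only one-way (resp. two-way) edges all amount to omitting finitely many small graphs,
-- which serve as the constants.  For edgeless A and B, the perfect matching PM |A| false of |A|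
-- one-way edges is the ⊑-greatest one-way matching graph with independence number |A|: every such
-- graph embeds into it (the classification below).  Likewise PM |B| true for two-way edges.  Their
-- least upper bound among matching graphs is their disjoint union, with independence number
-- |A| + |B|.  So C ≅ E_{|A|+|B|} says: C is edgeless and its size is the independence number of
-- that least upper bound, a first-order condition.

open import Defs
open import Data.Nat using (ℕ; zero; suc; _+_; _≤_; _≤?_; z≤n; s≤s)
open import Data.Nat.Properties using (≤-trans; m≤m+n; ≤-refl; ≤-reflexive; ≤-antisym; <-irrefl) renaming (_≟_ to _≟ℕ_)
open import Data.Fin using (Fin; zero; suc; splitAt; join; _↑ˡ_; _↑ʳ_; inject≤)
open import Data.Fin.Properties using (injective⇒≤; inject≤-injective; splitAt-join; join-splitAt; splitAt-↑ˡ; splitAt-↑ʳ; any?) renaming (_≟_ to _≟ᶠ_)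
open import Data.Bool using (Bool; true; false; not; _∧_; _∨_; if_then_else_)
open import Data.Bool.Properties using (not-¬; ¬-not; ∨-identityʳ; ∧-identityʳ; ∨-zeroʳ; ∧-zeroʳ; ∨-conicalˡ; ∨-conicalʳ; ∨-comm; ∧-comm) renaming (_≟_ to _≟ᵇ_)
open import Data.Vec using (Vec; []; _∷_; lookup; tabulate)
open import Data.Vec.Properties using (lookup∘tabulate)
open import Data.Vec.Functional using () renaming (_∷_ to _∷ᶠ_; [] to []ᶠ)
open import Data.Product using (Σ; _×_; _,_; proj₁; proj₂)
open import Data.Sum using (_⊎_; inj₁; inj₂; [_,_]′; swap) renaming (map to map⊎)
open import Data.Sum.Properties using (inj₁-injective; inj₂-injective)
open import Data.Empty using (⊥-elim)
open import Relation.Nullary using (¬_; Dec; yes; no; does; _⊎-dec_; _×-dec_; ¬?)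
open import Relation.Nullary.Decidable using (dec-true; dec-false; decidable-stable)
open import Relation.Binary.PropositionalEquality using (_≡_; _≢_; refl; sym; trans; cong; cong₂; subst; subst₂)
open import Function using (_∘_; id)
open import Function.Definitions using (Injective)
open import Function.Bundles using (_⇔_; mk⇔; Equivalence)
open import Function.Construct.Identity using (⇔-id)
open import Function.Construct.Symmetry using (⇔-sym)
open import Function.Construct.Composition using (_⇔-∘_)
open import Effect.Monad using (RawMonad)
import Level
open import Relation.Nullary.Negation using (¬¬-Monad)

Vertex : Digraph → Set
Vertex X = Fin (size X)

true≢false : true ≢ false
true≢false ()

adj : (X : Digraph) → Vertex X → Vertex X → Bool
adj X u v = edge X u v ∨ edge X v u

edge⇒adj : ∀ X {u v} → edge X u v ≡ true → adj X u v ≡ true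
edge⇒adj X {u} {v} e = cong (_∨ edge X v u) e

edge⇒adj˘ : ∀ X {u v} → edge X v u ≡ true → adj X u v ≡ true
edge⇒adj˘ X {u} {v} e = trans (cong (edge X u v ∨_) e) (∨-zeroʳ (edge X u v))

adj-sym : ∀ X {u v} → adj X u v ≡ true → adj X v u ≡ true
adj-sym X {u} {v} e = trans (∨-comm (edge X v u) (edge X u v)) e

∧-trueˡ : ∀ {x y} → x ∧ y ≡ true → x ≡ true
∧-trueˡ {true} _ = refl

∧-trueʳ : ∀ {x y} → x ∧ y ≡ true → y ≡ true
∧-trueʳ {true} e = e

Loopless Edgeless : Digraph → Set
Loopless X = ∀ u → edge X u u ≡ false
Edgeless X = ∀ u v → edge X u v ≡ false

adj-irrefl : ∀ X → Loopless X → ∀ {u v} → adj X u v ≡ true → u ≢ v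
adj-irrefl X ll {u} a refl = true≢false (trans (sym a) (cong₂ _∨_ (ll u) (ll u)))

⊑-refl : ∀ {G} → G ⊑ G
⊑-refl = id , id , λ _ _ → refl

⊑-trans : ∀ {G H I} → G ⊑ H → H ⊑ I → G ⊑ I
⊑-trans (f , f-inj , f-edge) (g , g-inj , g-edge) =
  g ∘ f , f-inj ∘ g-inj , λ i j → trans (f-edge i j) (g-edge (f i) (f j))

⊑-size : ∀ {G H} → G ⊑ H → size G ≤ size H
⊑-size (_ , f-inj , _) = injective⇒≤ f-inj

⊑-adj : ∀ G H (emb : G ⊑ H) x y → adj H (proj₁ emb x) (proj₁ emb y) ≡ adj G x y
⊑-adj G H (_ , _ , f-edge) x y = sym (cong₂ _∨_ (f-edge x y) (f-edge y x))

edge-⊑-edgeless : ∀ G X → Edgeless X → ∀ i j → edge G i j ≡ true → ¬ (G ⊑ X)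
edge-⊑-edgeless G X none i j e (f , _ , f-edge) = true≢false (trans (sym e) (trans (f-edge i j) (none _ _)))

edgeless-⊑ : ∀ G H → Edgeless G → Edgeless H → size G ≤ size H → G ⊑ H
edgeless-⊑ G H noneG noneH G≤H =
  (λ i → inject≤ i G≤H) , inject≤-injective G≤H G≤H _ _ , λ i j → trans (noneG i j) (sym (noneH _ _))

≅E⇔ : ∀ X s (p : 1 ≤ s) → X ≅ E s p ⇔ (Edgeless X × size X ≡ s)
≅E⇔ X s p = mk⇔ to from
  where
  to : X ≅ E s p → Edgeless X × size X ≡ s
  to (f , f-inj , f-surj , f-edge) = f-edge , ≤-antisym (injective⇒≤ f-inj) (injective⇒≤ g-inj)
    where
    g : Fin s → Vertex X
    g y = proj₁ (f-surj y)
    g-inj : Injective _≡_ _≡_ g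
    g-inj {x} {y} e = trans (sym (proj₂ (f-surj x) refl)) (trans (cong f e) (proj₂ (f-surj y) refl))
  from : Edgeless X × size X ≡ s → X ≅ E s p
  from (none , refl) = id , id , (λ y → y , id) , none

[]ᶠ-injective : ∀ {A : Set} → Injective _≡_ _≡_ ([]ᶠ {A = A})
[]ᶠ-injective {x = ()}

∷ᶠ-injective : ∀ {A : Set} {n} {v : A} {f : Fin n → A} →
               (∀ i → v ≢ f i) → Injective _≡_ _≡_ f → Injective _≡_ _≡_ (v ∷ᶠ f)
∷ᶠ-injective fresh f-inj {zero}  {zero}  _ = refl
∷ᶠ-injective fresh f-inj {zero}  {suc j} e = ⊥-elim (fresh j e)
∷ᶠ-injective fresh f-inj {suc i} {zero}  e = ⊥-elim (fresh i (sym e))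
∷ᶠ-injective fresh f-inj {suc i} {suc j} e = cong suc (f-inj e)

Loop : Digraph
Loop = digraph 1 (s≤s z≤n) (λ _ _ → true)

twoEdges : Bool → Bool → Fin 2 → Fin 2 → Bool
twoEdges a a' zero       (suc zero) = a
twoEdges a a' (suc zero) zero       = a'
twoEdges a a' _          _          = false

TwoVertex : Bool → Bool → Digraph
TwoVertex a a' = digraph 2 (s≤s z≤n) (twoEdges a a')

-- An edge whose reverse is present exactly when b is false: it violates the orientation
-- pattern b (one-way edges for b = false, two-way edges for b = true).
Misoriented : Bool → Digraph
Misoriented b = TwoVertex true (not b)

Arc Digon : Digraph
Arc   = Misoriented true
Digon = Misoriented false

loop-⊑ : ∀ X u → edge X u u ≡ true → Loop ⊑ X
loop-⊑ X u e = (λ _ → u) , (λ { {zero} {zero} _ → refl }) , λ { zero zero → sym e }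

loopless⇔ : ∀ X → Loopless X ⇔ (¬ (Loop ⊑ X))
loopless⇔ X = mk⇔ (λ ll (f , _ , f-edge) → true≢false (trans (f-edge zero zero) (ll (f zero)))) from
  where
  from : ¬ (Loop ⊑ X) → Loopless X
  from noLoop u with edge X u u in e
  ... | true  = ⊥-elim (noLoop (loop-⊑ X u e))
  ... | false = refl

pair-⊑ : ∀ X → Loopless X → ∀ {u w} → u ≢ w → TwoVertex (edge X u w) (edge X w u) ⊑ X
pair-⊑ X ll {u} {w} u≢w = (u ∷ᶠ w ∷ᶠ []ᶠ) , ∷ᶠ-injective fresh (∷ᶠ-injective (λ ()) []ᶠ-injective) , edges
  where
  fresh : ∀ i → u ≢ (w ∷ᶠ []ᶠ) i
  fresh zero = u≢w
  edges : ∀ i j → twoEdges (edge X u w) (edge X w u) i j ≡ edge X ((u ∷ᶠ w ∷ᶠ []ᶠ) i) ((u ∷ᶠ w ∷ᶠ []ᶠ) j)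
  edges zero       zero       = sym (ll u)
  edges zero       (suc zero) = refl
  edges (suc zero) zero       = refl
  edges (suc zero) (suc zero) = sym (ll w)

misoriented-⊑ : ∀ X b → Loopless X → ∀ {u w} → u ≢ w →
                edge X u w ≡ true → edge X w u ≡ not b → Misoriented b ⊑ X
misoriented-⊑ X b ll u≢w e e' = subst₂ (λ a a' → TwoVertex a a' ⊑ X) e e' (pair-⊑ X ll u≢w)

edgeless⇔ : ∀ X → Edgeless X ⇔ (¬ (Arc ⊑ X) × ¬ (Digon ⊑ X) × ¬ (Loop ⊑ X))
edgeless⇔ X = mk⇔ to from
  where
  to : Edgeless X → ¬ (Arc ⊑ X) × ¬ (Digon ⊑ X) × ¬ (Loop ⊑ X)
  to none = edge-⊑-edgeless Arc X none zero (suc zero) refl , edge-⊑-edgeless Digon X none zero (suc zero) refl ,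
            edge-⊑-edgeless Loop X none zero zero refl
  from : ¬ (Arc ⊑ X) × ¬ (Digon ⊑ X) × ¬ (Loop ⊑ X) → Edgeless X
  from (noArc , noDigon , noLoop) = noEdge
    where
    ll : Loopless X
    ll = Equivalence.from (loopless⇔ X) noLoop
    noEdge : Edgeless X
    noEdge u w with u ≟ᶠ w
    ... | yes refl = ll u
    ... | no u≢w with edge X u w in e
    ...   | false = refl
    ...   | true with edge X w u in e'
    ...     | true  = ⊥-elim (noDigon (misoriented-⊑ X false ll u≢w e e'))
    ...     | false = ⊥-elim (noArc (misoriented-⊑ X true ll u≢w e e'))

Oriented : Bool → Digraph → Set
Oriented b X = ∀ u w → u ≢ w → edge X u w ≡ true → edge X w u ≡ b

oriented⇔ : ∀ X b → Loopless X → Oriented b X ⇔ (¬ (Misoriented b ⊑ X))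
oriented⇔ X b ll = mk⇔ to from
  where
  to : Oriented b X → ¬ (Misoriented b ⊑ X)
  to or (f , f-inj , f-edge) =
    not-¬ (or (f zero) (f (suc zero)) (λ e → 0≢1 (f-inj e)) (sym (f-edge zero (suc zero)))) (sym (f-edge (suc zero) zero))
    where
    0≢1 : Fin.zero {1} ≢ suc zero
    0≢1 ()
  from : ¬ (Misoriented b ⊑ X) → Oriented b X
  from noMis u w u≢w e with edge X w u ≟ᵇ b
  ... | yes e' = e'
  ... | no  e' = ⊥-elim (noMis (misoriented-⊑ X b ll u≢w e (¬-not e')))

Matching : Digraph → Set
Matching X = Loopless X × (∀ u v w → adj X u v ≡ true → adj X u w ≡ true → v ≡ w)

threeEdges : Vec Bool 6 → Fin 3 → Fin 3 → Bool
threeEdges (a ∷ _ ∷ _ ∷ _ ∷ _ ∷ _ ∷ []) zero             (suc zero)       = a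
threeEdges (_ ∷ a ∷ _ ∷ _ ∷ _ ∷ _ ∷ []) (suc zero)       zero             = a
threeEdges (_ ∷ _ ∷ a ∷ _ ∷ _ ∷ _ ∷ []) zero             (suc (suc zero)) = a
threeEdges (_ ∷ _ ∷ _ ∷ a ∷ _ ∷ _ ∷ []) (suc (suc zero)) zero             = a
threeEdges (_ ∷ _ ∷ _ ∷ _ ∷ a ∷ _ ∷ []) (suc zero)       (suc (suc zero)) = a
threeEdges (_ ∷ _ ∷ _ ∷ _ ∷ _ ∷ a ∷ []) (suc (suc zero)) (suc zero)       = a
threeEdges _ _ _ = false

ThreeVertex : Vec Bool 6 → Digraph
ThreeVertex bs = digraph 3 (s≤s z≤n) (threeEdges bs)

-- The bit vectors for which vertex 0 is adjacent to both other vertices; these three-vertex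
-- graphs are exactly the ones a matching graph must omit.
cherry : Vec Bool 6 → Bool
cherry (a₀₁ ∷ a₁₀ ∷ a₀₂ ∷ a₂₀ ∷ _) = (a₀₁ ∨ a₁₀) ∧ (a₀₂ ∨ a₂₀)

profile : ∀ X → Vertex X → Vertex X → Vertex X → Vec Bool 6
profile X u v w = edge X u v ∷ edge X v u ∷ edge X u w ∷ edge X w u ∷ edge X v w ∷ edge X w v ∷ []

triple-⊑ : ∀ X → Loopless X → ∀ {u v w} → u ≢ v → u ≢ w → v ≢ w → ThreeVertex (profile X u v w) ⊑ X
triple-⊑ X ll {u} {v} {w} u≢v u≢w v≢w = t , ∷ᶠ-injective freshU (∷ᶠ-injective freshV (∷ᶠ-injective (λ ()) []ᶠ-injective)) , edges
  where
  t : Fin 3 → Vertex X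
  t = u ∷ᶠ v ∷ᶠ w ∷ᶠ []ᶠ
  freshU : ∀ i → u ≢ (v ∷ᶠ w ∷ᶠ []ᶠ) i
  freshU zero       = u≢v
  freshU (suc zero) = u≢w
  freshV : ∀ i → v ≢ (w ∷ᶠ []ᶠ) i
  freshV zero = v≢w
  edges : ∀ i j → threeEdges (profile X u v w) i j ≡ edge X (t i) (t j)
  edges zero             zero             = sym (ll u)
  edges (suc zero)       (suc zero)       = sym (ll v)
  edges (suc (suc zero)) (suc (suc zero)) = sym (ll w)
  edges zero             (suc zero)       = refl
  edges (suc zero)       zero             = refl
  edges zero             (suc (suc zero)) = refl
  edges (suc (suc zero)) zero             = refl
  edges (suc zero)       (suc (suc zero)) = refl
  edges (suc (suc zero)) (suc zero)       = refl

-- A matching graph omits every cherry: its vertex 0 would have two distinct neighbours.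
matching-omits-cherry : ∀ X → Matching X → ∀ bs → cherry bs ≡ true → ¬ (ThreeVertex bs ⊑ X)
matching-omits-cherry X (_ , unique) bs@(a₀₁ ∷ a₁₀ ∷ a₀₂ ∷ a₂₀ ∷ _ ∷ _ ∷ []) isCherry (f , f-inj , f-edge) =
  1≢2 (f-inj (unique (f zero) (f (suc zero)) (f (suc (suc zero))) adj₀₁ adj₀₂))
  where
  1≢2 : Fin.suc {2} zero ≢ suc (suc zero)
  1≢2 ()
  adj₀₁ : adj X (f zero) (f (suc zero)) ≡ true
  adj₀₁ = trans (⊑-adj (ThreeVertex bs) X (f , f-inj , f-edge) zero (suc zero)) (∧-trueˡ isCherry)
  adj₀₂ : adj X (f zero) (f (suc (suc zero))) ≡ true
  adj₀₂ = trans (⊑-adj (ThreeVertex bs) X (f , f-inj , f-edge) zero (suc (suc zero))) (∧-trueʳ {a₀₁ ∨ a₁₀} isCherry)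

-- 2ⁿ, written so that Fin (2ⁿ⁺¹) splits as Fin 2ⁿ ⊎ Fin 2ⁿ.
twoPow : ℕ → ℕ
twoPow zero    = 1
twoPow (suc n) = twoPow n + twoPow n

bits : ∀ n → Fin (twoPow n) → Vec Bool n
bits zero    _ = []
bits (suc n) j = [ (true ∷_) ∘ bits n , (false ∷_) ∘ bits n ]′ (splitAt (twoPow n) j)

index : ∀ {n} → Vec Bool n → Fin (twoPow n)
index []                    = zero
index {suc n} (true  ∷ bs) = index bs ↑ˡ twoPow n
index {suc n} (false ∷ bs) = twoPow n ↑ʳ index bs

bits-index : ∀ {n} (bs : Vec Bool n) → bits n (index bs) ≡ bs
bits-index []                    = refl
bits-index {suc n} (true  ∷ bs) rewrite splitAt-↑ˡ (twoPow n) (index bs) (twoPow n) = cong (true ∷_) (bits-index bs)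
bits-index {suc n} (false ∷ bs) rewrite splitAt-↑ʳ (twoPow n) (twoPow n) (index bs) = cong (false ∷_) (bits-index bs)

-- The finitely many forbidden subgraphs of matching graphs: Loop and the 3-vertex cherries
-- (bit vectors that are not cherries contribute Loop again).
cherryOrLoop : Vec Bool 6 → Digraph
cherryOrLoop bs = if cherry bs then ThreeVertex bs else Loop

cherryOrLoop-cherry : ∀ bs → cherry bs ≡ true → cherryOrLoop bs ≡ ThreeVertex bs
cherryOrLoop-cherry bs isCherry rewrite isCherry = refl

Forbidden : ℕ
Forbidden = suc (twoPow 6)

forbidden : Fin Forbidden → Digraph
forbidden zero    = Loop
forbidden (suc j) = cherryOrLoop (bits 6 j)

matching⇔ : ∀ X → Matching X ⇔ (∀ j → ¬ (forbidden j ⊑ X))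
matching⇔ X = mk⇔ to from
  where
  to : Matching X → ∀ j → ¬ (forbidden j ⊑ X)
  to (ll , _) zero = Equivalence.to (loopless⇔ X) ll
  to m@(ll , _) (suc j) with cherry (bits 6 j) in isCherry
  ... | true  = matching-omits-cherry X m (bits 6 j) isCherry
  ... | false = Equivalence.to (loopless⇔ X) ll
  from : (∀ j → ¬ (forbidden j ⊑ X)) → Matching X
  from omits = ll , unique
    where
    ll : Loopless X
    ll = Equivalence.from (loopless⇔ X) (omits zero)
    unique : ∀ u v w → adj X u v ≡ true → adj X u w ≡ true → v ≡ w
    unique u v w uv uw with v ≟ᶠ w
    ... | yes v≡w = v≡w
    ... | no  v≢w = ⊥-elim (omits (suc (index p)) (subst (_⊑ X) (sym forbidden≡) triple))
      where
      p = profile X u v w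
      triple : ThreeVertex p ⊑ X
      triple = triple-⊑ X ll (adj-irrefl X ll uv) (adj-irrefl X ll uw) v≢w
      forbidden≡ : forbidden (suc (index p)) ≡ ThreeVertex p
      forbidden≡ = trans (cong cherryOrLoop (bits-index p)) (cherryOrLoop-cherry p (cong₂ _∧_ uv uw))

CliqueCover : Digraph → ℕ → Set
CliqueCover H c = Σ (Vertex H → Fin c) λ κ → ∀ u v → κ u ≡ κ v → u ≢ v → adj H u v ≡ true

-- An edgeless induced subgraph meets every clique at most once, so it has at most c vertices.
cover-bound : ∀ H {c} → CliqueCover H c → ∀ G → Edgeless G → G ⊑ H → size G ≤ c
cover-bound H (κ , cliques) G none (f , f-inj , f-edge) = injective⇒≤ inj
  where
  inj : Injective _≡_ _≡_ (κ ∘ f)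
  inj {x} {y} e with f x ≟ᶠ f y
  ... | yes fx≡fy = f-inj fx≡fy
  ... | no  fx≢fy = ⊥-elim (true≢false (trans (sym (cliques (f x) (f y) e fx≢fy))
                      (trans (⊑-adj G H (f , f-inj , f-edge) x y) (cong₂ _∨_ (none x y) (none y x)))))

-- I is an edgeless induced subgraph of X of maximum size (so size I is the independence number).
MaxIndependent : Digraph → Digraph → Set
MaxIndependent I X = Edgeless I × I ⊑ X × (∀ G → Edgeless G → G ⊑ X → size G ≤ size I)

Near : ∀ X {n} → (Fin n → Vertex X) → Vertex X → Fin n → Set
Near X f v i = v ≡ f i ⊎ adj X v (f i) ≡ true

-- An embedding of a maximum edgeless induced subgraph dominates: a vertex far from its image
-- would extend it to a larger edgeless induced subgraph.
maxIndependent-dominates : ∀ I X → Loopless X → MaxIndependent I X → (emb : I ⊑ X) →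
                           ∀ v → Σ (Vertex I) (Near X (proj₁ emb) v)
maxIndependent-dominates I X ll (noneI , _ , maximum) (f , f-inj , f-edge) v
  with any? (λ i → (v ≟ᶠ f i) ⊎-dec (adj X v (f i) ≟ᵇ true))
... | yes near = near
... | no  far  = ⊥-elim (<-irrefl refl (maximum (E (suc (size I)) (s≤s z≤n)) (λ _ _ → refl) bigger))
  where
  apart : ∀ i → adj X v (f i) ≡ false
  apart i = ¬-not (λ e → far (i , inj₂ e))
  g : Fin (suc (size I)) → Vertex X
  g = v ∷ᶠ f
  g-edge : ∀ i j → false ≡ edge X (g i) (g j)
  g-edge zero    zero    = sym (ll v)
  g-edge zero    (suc j) = sym (∨-conicalˡ _ _ (apart j))
  g-edge (suc i) zero    = sym (∨-conicalʳ _ _ (apart i))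
  g-edge (suc i) (suc j) = trans (sym (noneI i j)) (f-edge i j)
  bigger : E (suc (size I)) (s≤s z≤n) ⊑ X
  bigger = g , ∷ᶠ-injective (λ i e → far (i , inj₁ e)) f-inj , g-edge

maxIndependent-unique : ∀ {I J X Y} → MaxIndependent I X → MaxIndependent J Y → X ⊑ Y → Y ⊑ X → size I ≡ size J
maxIndependent-unique {I} {J} {X} {Y} (noneI , I⊑X , maxI) (noneJ , J⊑Y , maxJ) X⊑Y Y⊑X =
  ≤-antisym (maxJ I noneI (⊑-trans {I} {X} {Y} I⊑X X⊑Y)) (maxI J noneJ (⊑-trans {J} {Y} {X} J⊑Y Y⊑X))

TypedAt : Bool → ∀ X → Vertex X → Set
TypedAt b X v = Σ (Vertex X) λ v' → adj X v v' ≡ true × (edge X v v' ∧ edge X v' v ≡ b)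

Partnered : Bool → Digraph → Set
Partnered b X = ∀ v → TypedAt b X v

typed-⊑ : ∀ {b} X W (emb : X ⊑ W) {x} → TypedAt b X x → TypedAt b W (proj₁ emb x)
typed-⊑ X W emb@(f , _ , f-edge) {x} (x' , a , t) = f x' , trans (⊑-adj X W emb x x') a , trans (sym (cong₂ _∧_ (f-edge x x') (f-edge x' x))) t

-- In a matching graph, a vertex on an edge of type b and a vertex on an edge of type ¬ b are
-- neither equal nor adjacent, since each vertex lies on at most one edge.
typed-apart : ∀ W b → Matching W → ∀ {u w} → TypedAt b W u → TypedAt (not b) W w → u ≢ w × adj W u w ≡ false
typed-apart W b (_ , unique) {u} {w} (u' , uu' , tu) (w' , ww' , tw) = distinct , ¬-not detached
  where
  b≢¬b : b ≢ not b
  b≢¬b = not-¬ refl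
  distinct : u ≢ w
  distinct refl with unique u u' w' uu' ww'
  ... | refl = b≢¬b (trans (sym tu) tw)
  detached : adj W u w ≢ true
  detached uw with unique u u' w uu' uw | unique w w' u ww' (adj-sym W uw)
  ... | refl | refl = b≢¬b (trans (sym tu) (trans (∧-comm (edge W u w) (edge W w u)) tw))

onSum : ∀ m n → 1 ≤ m + n → (Fin m ⊎ Fin n → Fin m ⊎ Fin n → Bool) → Digraph
onSum m n p F = digraph (m + n) p (λ u v → F (splitAt m u) (splitAt m v))

splitAt-injective : ∀ m {n} → Injective _≡_ _≡_ (splitAt m {n})
splitAt-injective m {n} {u} {v} e = trans (sym (join-splitAt m n u)) (trans (cong (join m n) e) (join-splitAt m n v))

join-injective : ∀ m n → Injective _≡_ _≡_ (join m n)
join-injective m n {a} {a'} e = trans (sym (splitAt-join m n a)) (trans (cong (splitAt m) e) (splitAt-join m n a'))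

module OnSum (m n : ℕ) (p : 1 ≤ m + n) (F : Fin m ⊎ Fin n → Fin m ⊎ Fin n → Bool) where

  into : ∀ X (h : Vertex X → Fin m ⊎ Fin n) → Injective _≡_ _≡_ h →
         (∀ x y → edge X x y ≡ F (h x) (h y)) → X ⊑ onSum m n p F
  into X h h-inj h-edge = join m n ∘ h , inj , edges
    where
    inj : Injective _≡_ _≡_ (join m n ∘ h)
    inj = h-inj ∘ join-injective m n
    edges : ∀ x y → edge X x y ≡ F (splitAt m (join m n (h x))) (splitAt m (join m n (h y)))
    edges x y rewrite splitAt-join m n (h x) | splitAt-join m n (h y) = h-edge x y

  outOf : ∀ X (g : Fin m ⊎ Fin n → Vertex X) → Injective _≡_ _≡_ g →
          (∀ a a' → F a a' ≡ edge X (g a) (g a')) → onSum m n p F ⊑ X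
  outOf X g g-inj g-edge = g ∘ splitAt m , splitAt-injective m ∘ g-inj , λ u v → g-edge (splitAt m u) (splitAt m v)

  matching : (∀ a → F a a ≡ false) →
             (∀ a a' a'' → F a a' ∨ F a' a ≡ true → F a a'' ∨ F a'' a ≡ true → a' ≡ a'') →
             Matching (onSum m n p F)
  matching diag unique = (λ u → diag (splitAt m u)) ,
    λ u v w uv uw → splitAt-injective m (unique (splitAt m u) (splitAt m v) (splitAt m w) uv uw)

  oriented : ∀ {b} → (∀ a a' → F a a' ≡ true → F a' a ≡ b) → Oriented b (onSum m n p F)
  oriented orient u w _ = orient (splitAt m u) (splitAt m w)

  partnered : ∀ {b} (σ : Fin m ⊎ Fin n → Fin m ⊎ Fin n) →
              (∀ a → (F a (σ a) ∨ F (σ a) a ≡ true) × (F a (σ a) ∧ F (σ a) a ≡ b)) → Partnered b (onSum m n p F)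
  partnered {b} σ typed u = join m n (σ a) , subst typedBy (sym (splitAt-join m n (σ a))) (typed a)
    where
    a = splitAt m u
    typedBy : Fin m ⊎ Fin n → Set
    typedBy a' = (F a a' ∨ F a' a ≡ true) × (F a a' ∧ F a' a ≡ b)

  cover : ∀ {c} (κ : Fin m ⊎ Fin n → Fin c) →
          (∀ a a' → κ a ≡ κ a' → a ≢ a' → F a a' ∨ F a' a ≡ true) → CliqueCover (onSum m n p F) c
  cover κ cliques = κ ∘ splitAt m , λ u v e u≢v → cliques (splitAt m u) (splitAt m v) e (u≢v ∘ splitAt-injective m)

_==_ : ∀ {c} → Fin c → Fin c → Bool
i == j = does (i ≟ᶠ j)

==-refl : ∀ {c} (i : Fin c) → (i == i) ≡ true
==-refl i = dec-true (i ≟ᶠ i) refl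

==-apart : ∀ {c} {i j : Fin c} → i ≢ j → (i == j) ≡ false
==-apart {i = i} {j} = dec-false (i ≟ᶠ j)

==-sound : ∀ {c} {i j : Fin c} → (i == j) ≡ true → i ≡ j
==-sound {i = i} {j} e with i ≟ᶠ j
... | yes i≡j = i≡j
... | no  _   = ⊥-elim (true≢false (sym e))

-- It is the model of a matching graph with c
-- components, all of orientation b.
pmEdges : ∀ {c} → Bool → Fin c ⊎ Fin c → Fin c ⊎ Fin c → Bool
pmEdges b (inj₁ i) (inj₂ j) = i == j
pmEdges b (inj₂ i) (inj₁ j) = b ∧ (i == j)
pmEdges b _        _        = false

pm-nonempty : ∀ {c} → 1 ≤ c → 1 ≤ c + c
pm-nonempty {c} p = ≤-trans p (m≤m+n c c)

PM : ∀ c → Bool → 1 ≤ c → Digraph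
PM c b p = onSum c c (pm-nonempty p) (pmEdges b)

pairOf : ∀ {c} → Fin c ⊎ Fin c → Fin c
pairOf = [ id , id ]′

pm-loopless : ∀ {c} b (a : Fin c ⊎ Fin c) → pmEdges b a a ≡ false
pm-loopless b (inj₁ i) = refl
pm-loopless b (inj₂ i) = refl

pm-adj : ∀ {c} b (a a' : Fin c ⊎ Fin c) → pmEdges b a a' ∨ pmEdges b a' a ≡ true → a' ≡ swap a
pm-adj b (inj₁ i) (inj₂ j) e with i == j in i=j
... | true  = cong inj₂ (sym (==-sound i=j))
... | false = cong inj₂ (==-sound (∧-trueʳ {b} e))
pm-adj b (inj₂ i) (inj₁ j) e with j == i in j=i
... | true  = cong inj₁ (==-sound j=i)
... | false rewrite ∨-identityʳ (b ∧ (i == j)) = cong inj₁ (sym (==-sound (∧-trueʳ {b} e)))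

pm-oriented : ∀ {c} b (a a' : Fin c ⊎ Fin c) → pmEdges b a a' ≡ true → pmEdges b a' a ≡ b
pm-oriented b (inj₁ i) (inj₂ j) e with ==-sound {i = i} {j} e
... | refl rewrite ==-refl i = ∧-identityʳ b
pm-oriented b (inj₂ i) (inj₁ j) e with ==-sound {i = i} {j} (∧-trueʳ {b} e)
... | refl rewrite ==-refl i = sym (∧-trueˡ e)

pm-same-pair : ∀ {c} b (a a' : Fin c ⊎ Fin c) → pairOf a ≡ pairOf a' → a ≢ a' → pmEdges b a a' ∨ pmEdges b a' a ≡ true
pm-same-pair b (inj₁ i) (inj₁ j) refl a≢a' = ⊥-elim (a≢a' refl)
pm-same-pair b (inj₂ i) (inj₂ j) refl a≢a' = ⊥-elim (a≢a' refl)
pm-same-pair b (inj₁ i) (inj₂ j) refl _ rewrite ==-refl i = refl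
pm-same-pair b (inj₂ i) (inj₁ j) refl _ rewrite ==-refl i = ∨-zeroʳ (b ∧ true)

pm-apart : ∀ {c} b (a a' : Fin c ⊎ Fin c) → pairOf a ≢ pairOf a' → pmEdges b a a' ≡ false
pm-apart b (inj₁ i) (inj₁ j) _   = refl
pm-apart b (inj₂ i) (inj₂ j) _   = refl
pm-apart b (inj₁ i) (inj₂ j) i≢j = ==-apart i≢j
pm-apart b (inj₂ i) (inj₁ j) i≢j rewrite ==-apart i≢j = ∧-zeroʳ b

pm-forward : ∀ {c} b (i : Fin c) → pmEdges b (inj₁ i) (inj₂ i) ≡ true
pm-forward b i = ==-refl i

pm-backward : ∀ {c} b (i : Fin c) → pmEdges b (inj₂ i) (inj₁ i) ≡ b
pm-backward b i rewrite ==-refl i = ∧-identityʳ b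

pm-partner : ∀ {c} b (a : Fin c ⊎ Fin c) →
             (pmEdges b a (swap a) ∨ pmEdges b (swap a) a ≡ true) × (pmEdges b a (swap a) ∧ pmEdges b (swap a) a ≡ b)
pm-partner b (inj₁ i) rewrite ==-refl i = refl , ∧-identityʳ b
pm-partner b (inj₂ i) rewrite ==-refl i = ∨-zeroʳ (b ∧ true) , trans (∧-identityʳ (b ∧ true)) (∧-identityʳ b)

module _ (c : ℕ) (b : Bool) (p : 1 ≤ c) where
  open OnSum c c (pm-nonempty p) (pmEdges b)

  PM-matching : Matching (PM c b p)
  PM-matching = matching (pm-loopless b) λ a a' a'' aa' aa'' → trans (pm-adj b a a' aa') (sym (pm-adj b a a'' aa''))

  PM-oriented : Oriented b (PM c b p)
  PM-oriented = oriented (pm-oriented b)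

  PM-cover : CliqueCover (PM c b p) c
  PM-cover = cover pairOf (pm-same-pair b)

  PM-partnered : Partnered b (PM c b p)
  PM-partnered = partnered swap (pm-partner b)

unionEdges : ∀ X Y → Vertex X ⊎ Vertex Y → Vertex X ⊎ Vertex Y → Bool
unionEdges X Y (inj₁ a) (inj₁ a') = edge X a a'
unionEdges X Y (inj₂ a) (inj₂ a') = edge Y a a'
unionEdges X Y _        _         = false

union-nonempty : ∀ X Y → 1 ≤ size X + size Y
union-nonempty X Y = ≤-trans (nonempty X) (m≤m+n (size X) (size Y))

infixl 25 _⊔_
_⊔_ : Digraph → Digraph → Digraph
X ⊔ Y = onSum (size X) (size Y) (union-nonempty X Y) (unionEdges X Y)

module _ (X Y : Digraph) where
  open OnSum (size X) (size Y) (union-nonempty X Y) (unionEdges X Y)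

  inl-⊑ : X ⊑ X ⊔ Y
  inl-⊑ = into X inj₁ inj₁-injective (λ _ _ → refl)

  inr-⊑ : Y ⊑ X ⊔ Y
  inr-⊑ = into Y inj₂ inj₂-injective (λ _ _ → refl)

  ⊔-edgeless : Edgeless X → Edgeless Y → Edgeless (X ⊔ Y)
  ⊔-edgeless noneX noneY u v = none (splitAt (size X) u) (splitAt (size X) v)
    where
    none : ∀ a a' → unionEdges X Y a a' ≡ false
    none (inj₁ a) (inj₁ a') = noneX a a'
    none (inj₂ a) (inj₂ a') = noneY a a'
    none (inj₁ a) (inj₂ a') = refl
    none (inj₂ a) (inj₁ a') = refl

  ⊔-matching : Matching X → Matching Y → Matching (X ⊔ Y)
  ⊔-matching (llX , uniqueX) (llY , uniqueY) = matching diag unique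
    where
    diag : ∀ a → unionEdges X Y a a ≡ false
    diag (inj₁ a) = llX a
    diag (inj₂ a) = llY a
    unique : ∀ a a' a'' → unionEdges X Y a a' ∨ unionEdges X Y a' a ≡ true →
             unionEdges X Y a a'' ∨ unionEdges X Y a'' a ≡ true → a' ≡ a''
    unique (inj₁ a) (inj₁ a') (inj₁ a'') e e' = cong inj₁ (uniqueX a a' a'' e e')
    unique (inj₂ a) (inj₂ a') (inj₂ a'') e e' = cong inj₂ (uniqueY a a' a'' e e')

  ⊔-cover : ∀ {c d} → CliqueCover X c → CliqueCover Y d → CliqueCover (X ⊔ Y) (c + d)
  ⊔-cover {c} {d} (κX , cliquesX) (κY , cliquesY) = cover (join c d ∘ map⊎ κX κY) cliques
    where
    cliques : ∀ a a' → join c d (map⊎ κX κY a) ≡ join c d (map⊎ κX κY a') → a ≢ a' →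
              unionEdges X Y a a' ∨ unionEdges X Y a' a ≡ true
    cliques (inj₁ a) (inj₁ a') e a≢a' = cliquesX a a' (inj₁-injective (join-injective c d e)) (a≢a' ∘ cong inj₁)
    cliques (inj₂ a) (inj₂ a') e a≢a' = cliquesY a a' (inj₂-injective (join-injective c d e)) (a≢a' ∘ cong inj₂)
    cliques (inj₁ a) (inj₂ a') e with join-injective c d {inj₁ (κX a)} {inj₂ (κY a')} e
    ... | ()
    cliques (inj₂ a) (inj₁ a') e with join-injective c d {inj₂ (κY a)} {inj₁ (κX a')} e
    ... | ()

  -- In a matching graph W, copies of X and Y can neither meet nor touch when every vertex of X
  -- lies on an edge of type b and every vertex of Y on one of type ¬ b; so W contains X ⊔ Y.
  ⊔-⊑ : ∀ b W → Matching W → Partnered b X → Partnered (not b) Y → X ⊑ W → Y ⊑ W → X ⊔ Y ⊑ W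
  ⊔-⊑ b W matchW typedX typedY embX@(f , f-inj , f-edge) embY@(g , g-inj , g-edge) = outOf W [ f , g ]′ inj edges
    where
    apart : ∀ x y → f x ≢ g y × adj W (f x) (g y) ≡ false
    apart x y = typed-apart W b matchW (typed-⊑ X W embX (typedX x)) (typed-⊑ Y W embY (typedY y))
    inj : Injective _≡_ _≡_ [ f , g ]′
    inj {inj₁ x} {inj₁ x'} e = cong inj₁ (f-inj e)
    inj {inj₂ y} {inj₂ y'} e = cong inj₂ (g-inj e)
    inj {inj₁ x} {inj₂ y}  e = ⊥-elim (proj₁ (apart x y) e)
    inj {inj₂ y} {inj₁ x}  e = ⊥-elim (proj₁ (apart x y) (sym e))
    edges : ∀ a a' → unionEdges X Y a a' ≡ edge W ([ f , g ]′ a) ([ f , g ]′ a')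
    edges (inj₁ x) (inj₁ x') = f-edge x x'
    edges (inj₂ y) (inj₂ y') = g-edge y y'
    edges (inj₁ x) (inj₂ y)  = sym (∨-conicalˡ _ _ (proj₂ (apart x y)))
    edges (inj₂ y) (inj₁ x)  = sym (∨-conicalʳ _ _ (proj₂ (apart x y)))

⊔-mono : ∀ {G H X Y} → G ⊑ X → H ⊑ Y → G ⊔ H ⊑ X ⊔ Y
⊔-mono {G} {H} {X} {Y} (f , f-inj , f-edge) (g , g-inj , g-edge) =
  OnSum.into (size X) (size Y) (union-nonempty X Y) (unionEdges X Y) (G ⊔ H) (k ∘ splitAt (size G))
    (splitAt-injective (size G) ∘ k-inj) (λ u v → k-edge (splitAt (size G) u) (splitAt (size G) v))
  where
  k : Vertex G ⊎ Vertex H → Vertex X ⊎ Vertex Y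
  k = map⊎ f g
  k-inj : Injective _≡_ _≡_ k
  k-inj {inj₁ a} {inj₁ a'} e = cong inj₁ (f-inj (inj₁-injective e))
  k-inj {inj₂ a} {inj₂ a'} e = cong inj₂ (g-inj (inj₂-injective e))
  k-edge : ∀ a a' → unionEdges G H a a' ≡ unionEdges X Y (k a) (k a')
  k-edge (inj₁ a) (inj₁ a') = f-edge a a'
  k-edge (inj₂ a) (inj₂ a') = g-edge a a'
  k-edge (inj₁ a) (inj₂ a') = refl
  k-edge (inj₂ a) (inj₁ a') = refl

-- The structure of a matching graph oriented by b, given a dominating edgeless family f:
-- each vertex v has a centre f i (v itself or its neighbour), and among the (at most two)
-- vertices sharing a centre, the head is the one entered by an edge that is one-way or
-- starts at the centre.  Sending tails to inj₁ and heads to inj₂ embeds X into PM n b.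
module Classification (X : Digraph) (b : Bool) (matchX : Matching X) (orientX : Oriented b X)
  {n : ℕ} (f : Fin n → Vertex X) (f-inj : Injective _≡_ _≡_ f) (indep : ∀ i j → edge X (f i) (f j) ≡ false)
  (dominated : ∀ v → Σ (Fin n) (Near X f v)) where

  private
    ll = proj₁ matchX
    unique = proj₂ matchX

  centreOf : Vertex X → Fin n
  centreOf v = proj₁ (dominated v)

  centre : Vertex X → Vertex X
  centre v = f (centreOf v)

  near-unique : ∀ {v i j} → Near X f v i → Near X f v j → i ≡ j
  near-unique (inj₁ v≡fi) (inj₁ v≡fj) = f-inj (trans (sym v≡fi) v≡fj)
  near-unique {i = i} {j} (inj₁ refl) (inj₂ a) = ⊥-elim (true≢false (trans (sym a) (cong₂ _∨_ (indep i j) (indep j i))))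
  near-unique {i = i} {j} (inj₂ a) (inj₁ refl) = ⊥-elim (true≢false (trans (sym a) (cong₂ _∨_ (indep j i) (indep i j))))
  near-unique {v} (inj₂ a) (inj₂ a') = f-inj (unique v _ _ a a')

  adj⇒same-centre : ∀ {u w} → adj X u w ≡ true → centreOf u ≡ centreOf w
  adj⇒same-centre {u} {w} a = near-unique w-near (proj₂ (dominated w))
    where
    w-near : Near X f w (centreOf u)
    w-near with proj₂ (dominated u)
    ... | inj₁ u≡c = inj₂ (subst (λ c → adj X w c ≡ true) u≡c (adj-sym X a))
    ... | inj₂ a'  = inj₁ (unique u w _ a a')

  same-centre : ∀ {u w} → centreOf u ≡ centreOf w → u ≢ w → adj X u w ≡ true × (u ≡ centre u ⊎ w ≡ centre w)
  same-centre {u} {w} c u≢w with proj₂ (dominated u) | subst (Near X f w) (sym c) (proj₂ (dominated w))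
  ... | inj₁ u≡c | inj₁ w≡c = ⊥-elim (u≢w (trans u≡c (sym w≡c)))
  ... | inj₁ u≡c | inj₂ a   = subst (λ x → adj X x w ≡ true) (sym u≡c) (adj-sym X a) , inj₁ u≡c
  ... | inj₂ a   | inj₁ w≡c = subst (λ x → adj X u x ≡ true) (sym w≡c) a , inj₂ (trans w≡c (cong f c))
  ... | inj₂ a   | inj₂ a'  = ⊥-elim (u≢w (unique _ u w (adj-sym X a) (adj-sym X a')))

  Head : Vertex X → Set
  Head v = Σ (Vertex X) λ x → edge X x v ≡ true × (edge X v x ≡ false ⊎ v ≢ centre v)

  head? : ∀ v → Dec (Head v)
  head? v = any? λ x → (edge X x v ≟ᵇ true) ×-dec ((edge X v x ≟ᵇ false) ⊎-dec ¬? (v ≟ᶠ centre v))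

  TailHead : Vertex X → Vertex X → Set
  TailHead u w = ¬ Head u × Head w × edge X u w ≡ true

  tail→head : ∀ {u w} → u ≢ w → edge X u w ≡ true → (edge X w u ≡ false ⊎ u ≡ centre u) → TailHead u w
  tail→head {u} {w} u≢w uw oneWayOrCentre = notHead , (u , uw , headCondition oneWayOrCentre) , uw
    where
    headCondition : edge X w u ≡ false ⊎ u ≡ centre u → edge X w u ≡ false ⊎ w ≢ centre w
    headCondition (inj₁ wu)  = inj₁ wu
    headCondition (inj₂ u≡c) = inj₂ λ w≡c → u≢w (trans u≡c (trans (cong f (adj⇒same-centre (edge⇒adj X uw))) (sym w≡c)))
    notHead : ¬ Head u
    notHead (x , xu , condition) with unique u x w (edge⇒adj˘ X xu) (edge⇒adj X uw)
    notHead (x , xu , inj₁ ux)  | refl = true≢false (trans (sym uw) ux)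
    notHead (x , xu , inj₂ u≢c) | refl = [ (λ wu → true≢false (trans (sym xu) wu)) , u≢c ]′ oneWayOrCentre

  orient : ∀ {u w} → centreOf u ≡ centreOf w → u ≢ w → TailHead u w ⊎ TailHead w u
  orient {u} {w} c u≢w with same-centre c u≢w | edge X u w ≟ᵇ true | edge X w u ≟ᵇ true
  ... | adjacent , _ | no ¬uw | no ¬wu = ⊥-elim (true≢false (trans (sym adjacent) (cong₂ _∨_ (¬-not ¬uw) (¬-not ¬wu))))
  ... | _ | yes uw | no ¬wu = inj₁ (tail→head u≢w uw (inj₁ (¬-not ¬wu)))
  ... | _ | no ¬uw | yes wu = inj₂ (tail→head (u≢w ∘ sym) wu (inj₁ (¬-not ¬uw)))
  ... | _ , inj₁ u≡c | yes uw | yes _  = inj₁ (tail→head u≢w uw (inj₂ u≡c))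
  ... | _ , inj₂ w≡c | yes _  | yes wu = inj₂ (tail→head (u≢w ∘ sym) wu (inj₂ w≡c))

  inj₁≢inj₂ : ∀ {i j : Fin n} → inj₁ {B = Fin n} i ≢ inj₂ j
  inj₁≢inj₂ ()

  h : Vertex X → Fin n ⊎ Fin n
  h v with head? v
  ... | yes _ = inj₂ (centreOf v)
  ... | no  _ = inj₁ (centreOf v)

  h-head : ∀ {v} → Head v → h v ≡ inj₂ (centreOf v)
  h-head {v} hd with head? v
  ... | yes _   = refl
  ... | no  ¬hd = ⊥-elim (¬hd hd)

  h-tail : ∀ {v} → ¬ Head v → h v ≡ inj₁ (centreOf v)
  h-tail {v} ¬hd with head? v
  ... | yes hd = ⊥-elim (¬hd hd)
  ... | no  _  = refl

  h-pair : ∀ v → pairOf (h v) ≡ centreOf v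
  h-pair v with head? v
  ... | yes _ = refl
  ... | no  _ = refl

  h-inj : Injective _≡_ _≡_ h
  h-inj {u} {w} e with u ≟ᶠ w
  ... | yes u≡w = u≡w
  ... | no  u≢w with orient (trans (sym (h-pair u)) (trans (cong pairOf e) (h-pair w))) u≢w
  ...   | inj₁ (¬hu , hw , _) = ⊥-elim (inj₁≢inj₂ (trans (sym (h-tail ¬hu)) (trans e (h-head hw))))
  ...   | inj₂ (¬hw , hu , _) = ⊥-elim (inj₁≢inj₂ (trans (sym (h-tail ¬hw)) (trans (sym e) (h-head hu))))

  h-edge : ∀ u w → edge X u w ≡ pmEdges b (h u) (h w)
  h-edge u w with u ≟ᶠ w
  ... | yes refl = trans (ll u) (sym (pm-loopless b (h u)))
  ... | no  u≢w with centreOf u ≟ᶠ centreOf w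
  ...   | no c≢c' = trans (¬-not (λ uw → c≢c' (adj⇒same-centre (edge⇒adj X uw))))
                          (sym (pm-apart b (h u) (h w) (λ e → c≢c' (trans (sym (h-pair u)) (trans e (h-pair w))))))
  ...   | yes c with orient c u≢w
  ...     | inj₁ (¬hu , hw , uw) rewrite h-tail ¬hu | h-head hw | c = trans uw (sym (pm-forward b (centreOf w)))
  ...     | inj₂ (¬hw , hu , wu) rewrite h-tail ¬hw | h-head hu | c =
              trans (orientX w u (u≢w ∘ sym) wu) (sym (pm-backward b (centreOf w)))

  classify : ∀ p → X ⊑ PM n b p
  classify p = OnSum.into n n (pm-nonempty p) (pmEdges b) X h h-inj h-edge

MatchingWith : Bool → Digraph → Digraph → Set
MatchingWith b I X = Matching X × Oriented b X × MaxIndependent I X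

matchingWith-⊑-PM : ∀ b I X → MatchingWith b I X → X ⊑ PM (size I) b (nonempty I)
matchingWith-⊑-PM b I X (matchX , orientX , max@(noneI , (f , f-inj , f-edge) , _)) =
  Classification.classify X b matchX orientX f f-inj (λ i j → trans (sym (f-edge i j)) (noneI i j))
    (maxIndependent-dominates I X (proj₁ matchX) max (f , f-inj , f-edge)) (nonempty I)

edgeless-⊑-PM : ∀ b I → Edgeless I → I ⊑ PM (size I) b (nonempty I)
edgeless-⊑-PM b I noneI = OnSum.into (size I) (size I) (pm-nonempty (nonempty I)) (pmEdges b) I inj₁ inj₁-injective noneI

PM-matchingWith : ∀ b I → Edgeless I → MatchingWith b I (PM (size I) b (nonempty I))
PM-matchingWith b I noneI = PM-matching c b p , PM-oriented c b p , noneI , edgeless-⊑-PM b I noneI ,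
  cover-bound (PM c b p) (PM-cover c b p)
  where
  c = size I
  p = nonempty I

-- X is ⊑-greatest (resp. W is ⊑-least) among the graphs with property P; comparisons are
-- double negated, as they are in the classical satisfaction of first-order formulas.
Greatest Least : (Digraph → Set) → Digraph → Set
Greatest P X = P X × (∀ G → P G → ¬ ¬ (G ⊑ X))
Least    P W = P W × (∀ G → P G → ¬ ¬ (W ⊑ G))

UpperMatching : Digraph → Digraph → Digraph → Set
UpperMatching X Y G = Matching G × X ⊑ G × Y ⊑ G

Witness : Digraph → Digraph → Digraph → Digraph → Digraph → Digraph → Set
Witness A B C W X Y = Greatest (MatchingWith false A) X × Greatest (MatchingWith true B) Y ×
                      Least (UpperMatching X Y) W × MaxIndependent C W

module Canonical (A B : Digraph) (noneA : Edgeless A) (noneB : Edgeless B) where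
  open RawMonad (¬¬-Monad {Level.zero}) using (pure; _>>=_)

  M D U : Digraph
  M = PM (size A) false (nonempty A)
  D = PM (size B) true (nonempty B)
  U = M ⊔ D

  M-greatest : Greatest (MatchingWith false A) M
  M-greatest = PM-matchingWith false A noneA , λ G withG → pure (matchingWith-⊑-PM false A G withG)

  D-greatest : Greatest (MatchingWith true B) D
  D-greatest = PM-matchingWith true B noneB , λ G withG → pure (matchingWith-⊑-PM true B G withG)

  U-⊑ : ∀ W → UpperMatching M D W → U ⊑ W
  U-⊑ W (matchW , M⊑W , D⊑W) =
    ⊔-⊑ M D false W matchW (PM-partnered (size A) false (nonempty A)) (PM-partnered (size B) true (nonempty B)) M⊑W D⊑W

  U-upper : ∀ {X Y} → X ⊑ M → Y ⊑ D → UpperMatching X Y U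
  U-upper {X} {Y} X⊑M Y⊑D =
    ⊔-matching M D (PM-matching (size A) false (nonempty A)) (PM-matching (size B) true (nonempty B)) ,
    ⊑-trans {X} {M} {U} X⊑M (inl-⊑ M D) , ⊑-trans {Y} {D} {U} Y⊑D (inr-⊑ M D)

  U-least : Least (UpperMatching M D) U
  U-least = U-upper {M} {D} (⊑-refl {M}) (⊑-refl {D}) , λ W upper → pure (U-⊑ W upper)

  -- U has independence number |A| + |B|: it contains the edgeless A ⊔ B and is covered by that many cliques.
  U-maxIndependent : ∀ I → Edgeless I → size I ≡ size A + size B → MaxIndependent I U
  U-maxIndependent I noneI |I| = noneI ,
    ⊑-trans {I} {A ⊔ B} {U} (edgeless-⊑ I (A ⊔ B) noneI (⊔-edgeless A B noneA noneB) (≤-reflexive |I|))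
                            (⊔-mono {A} {B} {M} {D} (edgeless-⊑-PM false A noneA) (edgeless-⊑-PM true B noneB)) ,
    λ G noneG G⊑U → ≤-trans (cover-bound U (⊔-cover M D (PM-cover (size A) false (nonempty A)) (PM-cover (size B) true (nonempty B))) G noneG G⊑U)
                            (≤-reflexive (sym |I|))

  -- Any witness configuration is equivalent to the canonical one, which forces |C| = |A| + |B|.
  witness-size : ∀ {C W X Y} → Witness A B C W X Y → ¬ ¬ (size C ≡ size A + size B)
  witness-size {C} {W} {X} {Y} ((withX , X-greatest) , (withY , Y-greatest) , ((matchW , X⊑W , Y⊑W) , W-least) , maxC) = do
    M⊑X ← X-greatest M (proj₁ M-greatest)
    D⊑Y ← Y-greatest D (proj₁ D-greatest)
    W⊑U ← W-least U (U-upper {X} {Y} (matchingWith-⊑-PM false A X withX) (matchingWith-⊑-PM true B Y withY))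
    let U⊑W = U-⊑ W (matchW , ⊑-trans {M} {X} {W} M⊑X X⊑W , ⊑-trans {D} {Y} {W} D⊑Y Y⊑W)
    pure (maxIndependent-unique {C} {A ⊔ B} {W} {U} maxC (U-maxIndependent (A ⊔ B) (⊔-edgeless A B noneA noneB) refl) W⊑U U⊑W)

  canonical-witness : ∀ C → Edgeless C → size C ≡ size A + size B → Witness A B C U M D
  canonical-witness C noneC |C| = M-greatest , D-greatest , U-least , U-maxIndependent C noneC |C|

-- Classical existence, which is how first-order satisfaction reads ∃ constructively.
Exists : (Digraph → Set) → Set
Exists P = ¬ ¬ Σ Digraph P

Defined : Digraph → Digraph → Digraph → Set
Defined A B C = Edgeless A × Edgeless B × Edgeless C ×
                Exists λ W → Exists λ X → Exists λ Y → Witness A B C W X Y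

defined⇔edgelessSum : ∀ A B C → Defined A B C ⇔ EdgelessSum A B C
defined⇔edgelessSum A B C = mk⇔ to from
  where
  open RawMonad (¬¬-Monad {Level.zero}) using (pure; _>>=_)
  to : Defined A B C → EdgelessSum A B C
  to (noneA , noneB , noneC , witnessed) =
    size A , nonempty A , size B , nonempty B ,
    Equivalence.from (≅E⇔ A (size A) (nonempty A)) (noneA , refl) ,
    Equivalence.from (≅E⇔ B (size B) (nonempty B)) (noneB , refl) ,
    Equivalence.from (≅E⇔ C (size A + size B) (union-nonempty A B)) (noneC , |C|)
    where
    open Canonical A B noneA noneB
    |C| : size C ≡ size A + size B
    |C| = decidable-stable (size C ≟ℕ size A + size B) (do
      W , forX ← witnessed
      X , forY ← forX
      Y , witness ← forY
      witness-size {C} {W} {X} {Y} witness)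
  from : EdgelessSum A B C → Defined A B C
  from (n , p , m , q , A≅ , B≅ , C≅)
    with Equivalence.to (≅E⇔ A n p) A≅ | Equivalence.to (≅E⇔ B m q) B≅
       | Equivalence.to (≅E⇔ C (n + m) (≤-trans p (m≤m+n n m))) C≅
  ... | noneA , refl | noneB , refl | noneC , |C| =
    noneA , noneB , noneC , pure (U , pure (M , pure (D , canonical-witness C noneC |C|)))
    where open Canonical A B noneA noneB

K : ℕ
K = 2 + Forbidden

constants : Vec Digraph K
constants = Arc ∷ Digon ∷ tabulate forbidden

misorientedConst : Bool → Fin K
misorientedConst true  = zero
misorientedConst false = suc zero

forbiddenConst : Fin Forbidden → Fin K
forbiddenConst j = suc (suc j)

Env : ℕ → Set
Env n = Fin n → Digraph

_≼_ : ∀ {n} → Fin n → Fin n → Formula K n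
i ≼ j = var i ⊑' var j

omits : ∀ {n} → Fin K → Fin n → Formula K n
omits c i = ¬' (const c ⊑' var i)

infixr 5 _⇒_
_⇒_ : ∀ {n} → Formula K n → Formula K n → Formula K n
φ ⇒ ψ = ¬' (φ ∧' (¬' ψ))

∃'_ : ∀ {n} → Formula K (suc n) → Formula K n
∃' φ = ¬' (∀' (¬' φ))

⋀ : ∀ {n} ℓ → (Fin (suc ℓ) → Formula K n) → Formula K n
⋀ zero    φ = φ zero
⋀ (suc ℓ) φ = φ zero ∧' ⋀ ℓ (φ ∘ suc)

-- Sat turns the logical connectives into their (classical) meaning.  (The conjunction rule is
-- stated directly: the library's _×-⇔_ makes type checking of the formulas below much slower.)
infixr 4 _∧-⇔_
_∧-⇔_ : {P P' Q Q' : Set} → P ⇔ P' → Q ⇔ Q' → (P × Q) ⇔ (P' × Q')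
P⇔P' ∧-⇔ Q⇔Q' = mk⇔ (λ (p , q) → Equivalence.to P⇔P' p , Equivalence.to Q⇔Q' q)
                     (λ (p' , q') → Equivalence.from P⇔P' p' , Equivalence.from Q⇔Q' q')

Π-⇔ : {P Q : Digraph → Set} → (∀ G → P G ⇔ Q G) → ((G : Digraph) → P G) ⇔ ((G : Digraph) → Q G)
Π-⇔ P⇔Q = mk⇔ (λ p G → Equivalence.to (P⇔Q G) (p G)) (λ q G → Equivalence.from (P⇔Q G) (q G))

⇒-⇔ : {P P' Q Q' : Set} → P ⇔ P' → Q ⇔ Q' → (¬ (P × ¬ Q)) ⇔ (P' → ¬ ¬ Q')
⇒-⇔ P⇔P' Q⇔Q' = mk⇔ (λ h p' ¬q' → h (Equivalence.from P⇔P' p' , ¬q' ∘ Equivalence.to Q⇔Q'))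
                     (λ h (p , ¬q) → h (Equivalence.to P⇔P' p) (¬q ∘ Equivalence.from Q⇔Q'))

∃-⇔ : {P Q : Digraph → Set} → (∀ G → P G ⇔ Q G) → (¬ ((G : Digraph) → ¬ P G)) ⇔ Exists Q
∃-⇔ P⇔Q = mk⇔ (λ h ¬q → h λ G p → ¬q (G , Equivalence.to (P⇔Q G) p))
               (λ h ¬p → h λ (G , q) → ¬p G (Equivalence.from (P⇔Q G) q))

sat-⋀ : ∀ {n} (ρ : Env n) ℓ φ → Sat constants ρ (⋀ ℓ φ) ⇔ (∀ j → Sat constants ρ (φ j))
sat-⋀ ρ zero    φ = mk⇔ (λ { s zero → s }) (λ s → s zero)
sat-⋀ ρ (suc ℓ) φ = mk⇔ (λ { (s , ss) zero → s ; (s , ss) (suc j) → Equivalence.to (sat-⋀ ρ ℓ (φ ∘ suc)) ss j })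
                        (λ s → s zero , Equivalence.from (sat-⋀ ρ ℓ (φ ∘ suc)) (s ∘ suc))

edgelessF : ∀ {n} → Fin n → Formula K n
edgelessF i = omits (misorientedConst true) i ∧' (omits (misorientedConst false) i ∧' omits (forbiddenConst zero) i)

sat-edgeless : ∀ {n} (ρ : Env n) i → Sat constants ρ (edgelessF i) ⇔ Edgeless (ρ i)
sat-edgeless ρ i = ⇔-sym (edgeless⇔ (ρ i))

matchingF : ∀ {n} → Fin n → Formula K n
matchingF i = ⋀ (twoPow 6) λ j → omits (forbiddenConst j) i

lookup-forbidden : ∀ j → lookup constants (forbiddenConst j) ≡ forbidden j
lookup-forbidden = lookup∘tabulate forbidden

sat-matching : ∀ {n} (ρ : Env n) i → Sat constants ρ (matchingF i) ⇔ Matching (ρ i)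
sat-matching ρ i = mk⇔
  (λ s → Equivalence.from (matching⇔ (ρ i)) λ j →
           subst (λ G → ¬ (G ⊑ ρ i)) (lookup-forbidden j) (Equivalence.to (sat-⋀ ρ (twoPow 6) (λ j → omits (forbiddenConst j) i)) s j))
  (λ m → Equivalence.from (sat-⋀ ρ (twoPow 6) (λ j → omits (forbiddenConst j) i)) λ j →
           subst (λ G → ¬ (G ⊑ ρ i)) (sym (lookup-forbidden j)) (Equivalence.to (matching⇔ (ρ i)) m j))

sat-misoriented : ∀ {n} (ρ : Env n) b i → Sat constants ρ (omits (misorientedConst b) i) ⇔ (¬ (Misoriented b ⊑ ρ i))
sat-misoriented ρ true  i = ⇔-id _
sat-misoriented ρ false i = ⇔-id _

maxIndependentF : ∀ {n} → Fin n → Fin n → Formula K n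
maxIndependentF e x = edgelessF e ∧' ((e ≼ x) ∧' (∀' ((edgelessF zero ∧' (zero ≼ suc x)) ⇒ (zero ≼ suc e))))

-- The formula says "every edgeless G ⊑ X has G ⊑ I"; among edgeless graphs this is the size bound.
sat-maxIndependent : ∀ {n} (ρ : Env n) e x → Sat constants ρ (maxIndependentF e x) ⇔ MaxIndependent (ρ e) (ρ x)
sat-maxIndependent ρ e x = mk⇔ to from
  where
  to : Sat constants ρ (maxIndependentF e x) → MaxIndependent (ρ e) (ρ x)
  to (noneI , I⊑X , bounded) = Equivalence.to (sat-edgeless ρ e) noneI , I⊑X , λ G noneG G⊑X →
    decidable-stable (size G ≤? size (ρ e)) λ G≰I →
      bounded G ((Equivalence.from (sat-edgeless (extend G ρ) zero) noneG , G⊑X) , λ G⊑I → G≰I (⊑-size {G} {ρ e} G⊑I))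
  from : MaxIndependent (ρ e) (ρ x) → Sat constants ρ (maxIndependentF e x)
  from (noneI , I⊑X , bound) = Equivalence.from (sat-edgeless ρ e) noneI , I⊑X , λ G ((noneG , G⊑X) , G⋢I) →
    G⋢I (edgeless-⊑ G (ρ e) (Equivalence.to (sat-edgeless (extend G ρ) zero) noneG) noneI
                       (bound G (Equivalence.to (sat-edgeless (extend G ρ) zero) noneG) G⊑X))

matchingWithF : ∀ {n} → Bool → Fin n → Fin n → Formula K n
matchingWithF b e x = matchingF x ∧' (omits (misorientedConst b) x ∧' maxIndependentF e x)

sat-matchingWith : ∀ {n} (ρ : Env n) b e x → Sat constants ρ (matchingWithF b e x) ⇔ MatchingWith b (ρ e) (ρ x)
sat-matchingWith ρ b e x = mk⇔ to from
  where
  to : Sat constants ρ (matchingWithF b e x) → MatchingWith b (ρ e) (ρ x)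
  to (m , o , i) = matchX , Equivalence.from (oriented⇔ (ρ x) b (proj₁ matchX)) (Equivalence.to (sat-misoriented ρ b x) o) ,
                   Equivalence.to (sat-maxIndependent ρ e x) i
    where matchX = Equivalence.to (sat-matching ρ x) m
  from : MatchingWith b (ρ e) (ρ x) → Sat constants ρ (matchingWithF b e x)
  from (matchX , orientX , maxI) = Equivalence.from (sat-matching ρ x) matchX ,
    Equivalence.from (sat-misoriented ρ b x) (Equivalence.to (oriented⇔ (ρ x) b (proj₁ matchX)) orientX) ,
    Equivalence.from (sat-maxIndependent ρ e x) maxI

greatestMatchingF : ∀ {n} → Bool → Fin n → Fin n → Formula K n
greatestMatchingF b e x = matchingWithF b e x ∧' (∀' (matchingWithF b (suc e) zero ⇒ (zero ≼ suc x)))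

sat-greatestMatching : ∀ {n} (ρ : Env n) b e x →
                       Sat constants ρ (greatestMatchingF b e x) ⇔ Greatest (MatchingWith b (ρ e)) (ρ x)
sat-greatestMatching ρ b e x =
  sat-matchingWith ρ b e x ∧-⇔ Π-⇔ λ G → ⇒-⇔ (sat-matchingWith (extend G ρ) b (suc e) zero) (⇔-id _)

upperF : ∀ {n} → Fin n → Fin n → Fin n → Formula K n
upperF x y w = matchingF w ∧' ((x ≼ w) ∧' (y ≼ w))

sat-upper : ∀ {n} (ρ : Env n) x y w → Sat constants ρ (upperF x y w) ⇔ UpperMatching (ρ x) (ρ y) (ρ w)
sat-upper ρ x y w = sat-matching ρ w ∧-⇔ ⇔-id _

leastUpperF : ∀ {n} → Fin n → Fin n → Fin n → Formula K n
leastUpperF x y w = upperF x y w ∧' (∀' (upperF (suc x) (suc y) zero ⇒ (suc w ≼ zero)))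

sat-leastUpper : ∀ {n} (ρ : Env n) x y w → Sat constants ρ (leastUpperF x y w) ⇔ Least (UpperMatching (ρ x) (ρ y)) (ρ w)
sat-leastUpper ρ x y w =
  sat-upper ρ x y w ∧-⇔ Π-⇔ λ G → ⇒-⇔ (sat-upper (extend G ρ) (suc x) (suc y) zero) (⇔-id _)

-- The variables of witnessF, innermost first: Y, X, W, then A, B, C.
𝒀 𝑿 𝑾 𝑨 𝑩 𝑪 : Fin 6
𝒀 = zero
𝑿 = suc zero
𝑾 = suc (suc zero)
𝑨 = suc (suc (suc zero))
𝑩 = suc (suc (suc (suc zero)))
𝑪 = suc (suc (suc (suc (suc zero))))

witnessF : Formula K 6
witnessF = greatestMatchingF false 𝑨 𝑿 ∧' (greatestMatchingF true 𝑩 𝒀 ∧' (leastUpperF 𝑿 𝒀 𝑾 ∧' maxIndependentF 𝑪 𝑾))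

sat-witness : ∀ (ρ : Env 6) → Sat constants ρ witnessF ⇔ Witness (ρ 𝑨) (ρ 𝑩) (ρ 𝑪) (ρ 𝑾) (ρ 𝑿) (ρ 𝒀)
sat-witness ρ =
  sat-greatestMatching ρ false 𝑨 𝑿 ∧-⇔ (sat-greatestMatching ρ true 𝑩 𝒀 ∧-⇔
    (sat-leastUpper ρ 𝑿 𝒀 𝑾 ∧-⇔ sat-maxIndependent ρ 𝑪 𝑾))

definingFormula : Formula K 3
definingFormula = edgelessF zero ∧' (edgelessF (suc zero) ∧' (edgelessF (suc (suc zero)) ∧' (∃' (∃' (∃' witnessF)))))

sat-defining : ∀ A B C → Sat constants (env3 A B C) definingFormula ⇔ Defined A B C
sat-defining A B C =
  sat-edgeless ρ zero ∧-⇔ (sat-edgeless ρ (suc zero) ∧-⇔ (sat-edgeless ρ (suc (suc zero)) ∧-⇔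
    ∃-⇔ λ W → ∃-⇔ λ X → ∃-⇔ λ Y → sat-witness (extend Y (extend X (extend W ρ)))))
  where ρ = env3 A B C

lemma6 : Σ ℕ λ k → Σ (Vec Digraph k) λ cs → Σ (Formula k 3) λ φ →
           (A B C : Digraph) → Sat cs (env3 A B C) φ ⇔ EdgelessSum A B C
lemma6 = K , constants , definingFormula , λ A B C → defined⇔edgelessSum A B C ⇔-∘ sat-defining A B C
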